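{- Let $m, n, k, l, t, r$ be positive integers satisfying $k\geq l \geq t+r$ and $\min\{m, n\}\geq k+l-t+2$. Let $T$ be a $(t+2r)$-element subset of $[\min\{m,n\}]$ and fix $j\in [\min\{m,n\}]\setminus T$. Then for any subsets $A\in \binom{[n]\setminus (T\cup \{j\})}{k-r-t}$ and $B \in \binom{[m]\setminus (T\cup \{j\})}{l-r-t}$ with $|A\cap B|=w$, there exist subsets $A_1, A_2, \ldots, A_{w+1} \in \binom{[n]\setminus (T\cup \{j\})}{k-r-t}$ and $B_1, B_2, \ldots, B_{w+1} \in \binom{[m]\setminus (T\cup \{j\})}{l-r-t}$ such that (1) $A_i \cap B_i=\emptyset$ for $i=1,\ldots, w+1$; (2) $A_{i+1} \cap B_i=\emptyset$ for $i=1,\ldots, w$; (3) $A_1=A$ and $B_{w+1}=B$.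
   Context: $[n]=\{1,\dots,n\}$ and $\binom{X}{k}$ denotes the family of all $k$-element subsets of $X$. -}

module Defs where

open import Data.Nat using (ℕ; _<_)
open import Data.Fin using (Fin; toℕ)
open import Data.Fin.Subset using (Subset; _∈_; _∩_; _∪_; ⊥; ⁅_⁆; ∣_∣)
open import Data.Product using (_×_)
open import Relation.Binary.PropositionalEquality using (_≡_)

-- Convention: finite sets of positive integers are represented as subsets of
-- a common ambient Fin N, where the element i : Fin N stands for the integer
-- toℕ i + 1.  Thus "X ⊆ [n]" means every element i of X has toℕ i < n.

WithinRange : {N : ℕ} → ℕ → Subset N → Set
WithinRange n X = ∀ i → i ∈ X → toℕ i < n

InFamily : {N : ℕ} → ℕ → Subset N → Fin N → ℕ → Subset N → Set
InFamily n T j s X = WithinRange n X × (X ∩ (T ∪ ⁅ j ⁆) ≡ ⊥) × (∣ X ∣ ≡ s)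

{-# OPTIONS --safe #-}

-- Induction on w = |A ∩ B|.  Write S = T ∪ {j}.  If w > 0, exchange some x ∈ A ∩ B for
-- some z ∈ [min{m,n}] outside S ∪ A ∪ B; this gives an admissible A′ with |A′ ∩ B| = w − 1.
-- Then choose an admissible B₁ ⊆ [min{m,n}] avoiding S ∪ A ∪ {z}, so B₁ misses both A and A′,
-- and put (A, B₁) in front of the chain for (A′, B).  Both choices are possible because
-- |S| + |A| + |B| ≤ (t + 2r + 1) + (k − r − t) + (l − r − t) = k + l − t + 1 < min{m,n}.

module Submission where

open import Defs
open import Data.Bool.Properties using (∧-zeroʳ)
open import Data.Fin using (Fin; toℕ; zero; suc; inject₁; fromℕ)
open import Data.Fin.Subset using (Subset; inside; outside; _∈_; _∉_; _⊆_; _∩_; _∪_; _─_; ⊥; ⁅_⁆; ∣_∣)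
open import Data.Fin.Subset.Properties
open import Data.Nat using (ℕ; zero; suc; z≤n; s≤s; _+_; _*_; _∸_; _≤_; _<_; _⊔_; _⊓_)
open import Data.Nat.Properties
open import Data.Nat.Tactic.RingSolver using (solve-∀)
open import Data.Product using (Σ; ∃; ∃₂; _×_; _,_)
open import Data.Sum using ([_,_]; map₁)
open import Data.Vec using ([]; _∷_; here; there)
import Data.Vec.Functional as Vector
open import Relation.Binary.PropositionalEquality
  using (_≡_; refl; sym; trans; cong; cong₂; subst; module ≡-Reasoning)
open import Relation.Nullary using (contradiction)

private
  variable
    N M n b : ℕ
    p q r p′ q′ : Subset N

∣p∣≡0⇒p≡⊥ : (p : Subset N) → ∣ p ∣ ≡ 0 → p ≡ ⊥
∣p∣≡0⇒p≡⊥ []            _ = refl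
∣p∣≡0⇒p≡⊥ (outside ∷ p) e = cong (outside ∷_) (∣p∣≡0⇒p≡⊥ p e)

∣p∪q∣+∣p∩q∣≡∣p∣+∣q∣ : (p q : Subset N) → ∣ p ∪ q ∣ + ∣ p ∩ q ∣ ≡ ∣ p ∣ + ∣ q ∣
∣p∪q∣+∣p∩q∣≡∣p∣+∣q∣ []            []            = refl
∣p∪q∣+∣p∩q∣≡∣p∣+∣q∣ (inside  ∷ p) (inside  ∷ q) =
  cong suc (trans (+-suc _ _) (trans (cong suc (∣p∪q∣+∣p∩q∣≡∣p∣+∣q∣ p q)) (sym (+-suc _ _))))
∣p∪q∣+∣p∩q∣≡∣p∣+∣q∣ (inside  ∷ p) (outside ∷ q) = cong suc (∣p∪q∣+∣p∩q∣≡∣p∣+∣q∣ p q)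
∣p∪q∣+∣p∩q∣≡∣p∣+∣q∣ (outside ∷ p) (inside  ∷ q) =
  trans (cong suc (∣p∪q∣+∣p∩q∣≡∣p∣+∣q∣ p q)) (sym (+-suc _ _))
∣p∪q∣+∣p∩q∣≡∣p∣+∣q∣ (outside ∷ p) (outside ∷ q) = ∣p∪q∣+∣p∩q∣≡∣p∣+∣q∣ p q

∣p∪q∣≤∣p∣+∣q∣ : (p q : Subset N) → ∣ p ∪ q ∣ ≤ ∣ p ∣ + ∣ q ∣
∣p∪q∣≤∣p∣+∣q∣ p q = m+n≤o⇒m≤o _ (≤-reflexive (∣p∪q∣+∣p∩q∣≡∣p∣+∣q∣ p q))

p∩q≡⊥⇒∣p∪q∣≡∣p∣+∣q∣ : (p q : Subset N) → p ∩ q ≡ ⊥ → ∣ p ∪ q ∣ ≡ ∣ p ∣ + ∣ q ∣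
p∩q≡⊥⇒∣p∪q∣≡∣p∣+∣q∣ {N} p q p∩q≡⊥ = begin
  ∣ p ∪ q ∣              ≡⟨ +-identityʳ _ ⟨
  ∣ p ∪ q ∣ + 0          ≡⟨ cong (∣ p ∪ q ∣ +_) (∣⊥∣≡0 N) ⟨
  ∣ p ∪ q ∣ + ∣ ⊥ {N} ∣  ≡⟨ cong (λ s → ∣ p ∪ q ∣ + ∣ s ∣) p∩q≡⊥ ⟨
  ∣ p ∪ q ∣ + ∣ p ∩ q ∣  ≡⟨ ∣p∪q∣+∣p∩q∣≡∣p∣+∣q∣ p q ⟩
  ∣ p ∣ + ∣ q ∣          ∎
  where open ≡-Reasoning

∣p─q∣+∣p∩q∣≡∣p∣ : (p q : Subset N) → ∣ p ─ q ∣ + ∣ p ∩ q ∣ ≡ ∣ p ∣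
∣p─q∣+∣p∩q∣≡∣p∣ []            []            = refl
∣p─q∣+∣p∩q∣≡∣p∣ (inside  ∷ p) (inside  ∷ q) = trans (+-suc _ _) (cong suc (∣p─q∣+∣p∩q∣≡∣p∣ p q))
∣p─q∣+∣p∩q∣≡∣p∣ (outside ∷ p) (inside  ∷ q) = ∣p─q∣+∣p∩q∣≡∣p∣ p q
∣p─q∣+∣p∩q∣≡∣p∣ (inside  ∷ p) (outside ∷ q) = cong suc (∣p─q∣+∣p∩q∣≡∣p∣ p q)
∣p─q∣+∣p∩q∣≡∣p∣ (outside ∷ p) (outside ∷ q) = ∣p─q∣+∣p∩q∣≡∣p∣ p q

∣p∣≤∣p─q∣+∣q∣ : (p q : Subset N) → ∣ p ∣ ≤ ∣ p ─ q ∣ + ∣ q ∣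
∣p∣≤∣p─q∣+∣q∣ p q = begin
  ∣ p ∣                  ≡⟨ ∣p─q∣+∣p∩q∣≡∣p∣ p q ⟨
  ∣ p ─ q ∣ + ∣ p ∩ q ∣  ≤⟨ +-monoʳ-≤ ∣ p ─ q ∣ (∣p∩q∣≤∣q∣ p q) ⟩
  ∣ p ─ q ∣ + ∣ q ∣      ∎
  where open ≤-Reasoning

q⊆p⇒p∩q≡q : q ⊆ p → p ∩ q ≡ q
q⊆p⇒p∩q≡q q⊆p = ⊆-antisym (p∩q⊆q _ _) (λ x∈q → x∈p∩q⁺ (q⊆p x∈q , x∈q))

q⊆p⇒∣p─q∣+∣q∣≡∣p∣ : (p q : Subset N) → q ⊆ p → ∣ p ─ q ∣ + ∣ q ∣ ≡ ∣ p ∣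
q⊆p⇒∣p─q∣+∣q∣≡∣p∣ p q q⊆p =
  trans (cong (λ s → ∣ p ─ q ∣ + ∣ s ∣) (sym (q⊆p⇒p∩q≡q q⊆p))) (∣p─q∣+∣p∩q∣≡∣p∣ p q)

subset-of-size : (p : Subset N) → b ≤ ∣ p ∣ → ∃ λ q → q ⊆ p × ∣ q ∣ ≡ b
subset-of-size {N} {zero} p _ = ⊥ , ⊥⊆ , ∣⊥∣≡0 N
subset-of-size {b = suc b} (inside ∷ p) (s≤s b≤∣p∣) =
  let q , q⊆p , ∣q∣≡b = subset-of-size p b≤∣p∣ in inside ∷ q , in⊆in q⊆p , cong suc ∣q∣≡b
subset-of-size {b = suc b} (outside ∷ p) b≤∣p∣ =
  let q , q⊆p , ∣q∣≡b = subset-of-size p b≤∣p∣ in outside ∷ q , out⊆ q⊆p , ∣q∣≡b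

∩≡⊥-antimono : p′ ⊆ p → q′ ⊆ q → p ∩ q ≡ ⊥ → p′ ∩ q′ ≡ ⊥
∩≡⊥-antimono p′⊆p q′⊆q p∩q≡⊥ = Empty-unique λ (x , x∈p′∩q′) →
  let x∈p′ , x∈q′ = x∈p∩q⁻ _ _ x∈p′∩q′
  in ∉⊥ (subst (x ∈_) p∩q≡⊥ (x∈p∩q⁺ (p′⊆p x∈p′ , q′⊆q x∈q′)))

∩≡⊥-sym : p ∩ q ≡ ⊥ → q ∩ p ≡ ⊥
∩≡⊥-sym {p = p} {q = q} = trans (∩-comm q p)

∪-∩≡⊥ : p ∩ r ≡ ⊥ → q ∩ r ≡ ⊥ → (p ∪ q) ∩ r ≡ ⊥
∪-∩≡⊥ {p = p} {r = r} {q = q} p∩r≡⊥ q∩r≡⊥ =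
  trans (∩-distribʳ-∪ r p q) (trans (cong₂ _∪_ p∩r≡⊥ q∩r≡⊥) (∪-idem ⊥))

[p─q]∩q≡⊥ : (p q : Subset N) → (p ─ q) ∩ q ≡ ⊥
[p─q]∩q≡⊥ []      []            = refl
[p─q]∩q≡⊥ (x ∷ p) (inside  ∷ q) = cong (outside ∷_) ([p─q]∩q≡⊥ p q)
[p─q]∩q≡⊥ (x ∷ p) (outside ∷ q) = cong₂ _∷_ (∧-zeroʳ x) ([p─q]∩q≡⊥ p q)

[p─q]∩r≡p∩r─q : (p q r : Subset N) → (p ─ q) ∩ r ≡ p ∩ r ─ q
[p─q]∩r≡p∩r─q []      []            []      = refl
[p─q]∩r≡p∩r─q (x ∷ p) (inside  ∷ q) (y ∷ r) = cong (outside ∷_) ([p─q]∩r≡p∩r─q p q r)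
[p─q]∩r≡p∩r─q (x ∷ p) (outside ∷ q) (y ∷ r) = cong (_ ∷_) ([p─q]∩r≡p∩r─q p q r)

∣p∪[q∪r]∣≤∣p∣+∣q∣+∣r∣ : (p q r : Subset N) → ∣ p ∪ (q ∪ r) ∣ ≤ ∣ p ∣ + ∣ q ∣ + ∣ r ∣
∣p∪[q∪r]∣≤∣p∣+∣q∣+∣r∣ p q r = begin
  ∣ p ∪ (q ∪ r) ∣            ≤⟨ ∣p∪q∣≤∣p∣+∣q∣ p (q ∪ r) ⟩
  ∣ p ∣ + ∣ q ∪ r ∣          ≤⟨ +-monoʳ-≤ ∣ p ∣ (∣p∪q∣≤∣p∣+∣q∣ q r) ⟩
  ∣ p ∣ + (∣ q ∣ + ∣ r ∣)    ≡⟨ +-assoc (∣ p ∣) (∣ q ∣) (∣ r ∣) ⟨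
  ∣ p ∣ + ∣ q ∣ + ∣ r ∣      ∎
  where open ≤-Reasoning

[p─q]∪r⊆p∪r : (p q r : Subset N) → (p ─ q) ∪ r ⊆ p ∪ r
[p─q]∪r⊆p∪r p q r x∈ = x∈p∪q⁺ (map₁ (p─q⊆p p q) (x∈p∪q⁻ (p ─ q) r x∈))

∣[p─q]∪r∣≡∣p∣ : (p q r : Subset N) → q ⊆ p → r ∩ p ≡ ⊥ → ∣ q ∣ ≡ ∣ r ∣ → ∣ (p ─ q) ∪ r ∣ ≡ ∣ p ∣
∣[p─q]∪r∣≡∣p∣ p q r q⊆p r∩p≡⊥ ∣q∣≡∣r∣ = begin
  ∣ (p ─ q) ∪ r ∣    ≡⟨ p∩q≡⊥⇒∣p∪q∣≡∣p∣+∣q∣ (p ─ q) r (∩≡⊥-antimono (p─q⊆p p q) ⊆-refl (∩≡⊥-sym r∩p≡⊥)) ⟩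
  ∣ p ─ q ∣ + ∣ r ∣  ≡⟨ cong (∣ p ─ q ∣ +_) ∣q∣≡∣r∣ ⟨
  ∣ p ─ q ∣ + ∣ q ∣  ≡⟨ q⊆p⇒∣p─q∣+∣q∣≡∣p∣ p q q⊆p ⟩
  ∣ p ∣              ∎
  where open ≡-Reasoning

∣[[p─q]∪r]∩s∣+∣q∣≡∣p∩s∣ : (p q r s : Subset N) → q ⊆ p ∩ s → r ∩ s ≡ ⊥ →
                          ∣ ((p ─ q) ∪ r) ∩ s ∣ + ∣ q ∣ ≡ ∣ p ∩ s ∣
∣[[p─q]∪r]∩s∣+∣q∣≡∣p∩s∣ p q r s q⊆p∩s r∩s≡⊥ = begin
  ∣ ((p ─ q) ∪ r) ∩ s ∣ + ∣ q ∣        ≡⟨ cong (λ x → ∣ x ∣ + ∣ q ∣) [[p─q]∪r]∩s≡p∩s─q ⟩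
  ∣ p ∩ s ─ q ∣ + ∣ q ∣                ≡⟨ q⊆p⇒∣p─q∣+∣q∣≡∣p∣ (p ∩ s) q q⊆p∩s ⟩
  ∣ p ∩ s ∣                            ∎
  where
  open ≡-Reasoning
  [[p─q]∪r]∩s≡p∩s─q : ((p ─ q) ∪ r) ∩ s ≡ p ∩ s ─ q
  [[p─q]∪r]∩s≡p∩s─q = begin
    ((p ─ q) ∪ r) ∩ s      ≡⟨ ∩-distribʳ-∪ s (p ─ q) r ⟩
    (p ─ q) ∩ s ∪ r ∩ s    ≡⟨ cong ((p ─ q) ∩ s ∪_) r∩s≡⊥ ⟩
    (p ─ q) ∩ s ∪ ⊥        ≡⟨ ∪-identityʳ _ ⟩
    (p ─ q) ∩ s            ≡⟨ [p─q]∩r≡p∩r─q p q s ⟩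
    p ∩ s ─ q              ∎

⁅<_⁆ : ℕ → Subset N
⁅<_⁆ {N = zero}  _       = []
⁅<_⁆ {N = suc N} zero    = ⊥
⁅<_⁆ {N = suc N} (suc M) = inside ∷ ⁅< M ⁆

⁅<⁆-withinRange : (M : ℕ) → WithinRange {N} M ⁅< M ⁆
⁅<⁆-withinRange {N = suc N} zero    i       i∈⊥        = contradiction i∈⊥ ∉⊥
⁅<⁆-withinRange {N = suc N} (suc M) zero    here       = s≤s z≤n
⁅<⁆-withinRange {N = suc N} (suc M) (suc i) (there i∈) = s≤s (⁅<⁆-withinRange M i i∈)

∣⁅<M⁆∣≡M : M ≤ N → ∣ ⁅<_⁆ {N} M ∣ ≡ M
∣⁅<M⁆∣≡M {N = zero}  z≤n       = refl
∣⁅<M⁆∣≡M {N = suc N} z≤n       = ∣⊥∣≡0 (suc N)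
∣⁅<M⁆∣≡M {N = suc N} (s≤s M≤N) = cong suc (∣⁅<M⁆∣≡M M≤N)

withinRange-⊆ : p ⊆ q → WithinRange n q → WithinRange n p
withinRange-⊆ p⊆q q<n i i∈p = q<n i (p⊆q i∈p)

withinRange-mono : M ≤ n → WithinRange M p → WithinRange n p
withinRange-mono M≤n p<M i i∈p = <-≤-trans (p<M i i∈p) M≤n

withinRange-∪ : WithinRange n p → WithinRange n q → WithinRange n (p ∪ q)
withinRange-∪ p<n q<n i i∈p∪q = [ p<n i , q<n i ] (x∈p∪q⁻ _ _ i∈p∪q)

fresh : M ≤ N → (p : Subset N) → ∣ p ∣ + b ≤ M → ∃ λ q → WithinRange M q × q ∩ p ≡ ⊥ × ∣ q ∣ ≡ b
fresh {M} {N} {b} M≤N p ∣p∣+b≤M =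
  let q , q⊆⁅<M⁆─p , ∣q∣≡b = subset-of-size (⁅< M ⁆ ─ p) room
  in q , withinRange-⊆ (⊆-trans q⊆⁅<M⁆─p (p─q⊆p _ p)) (⁅<⁆-withinRange M)
       , ∩≡⊥-antimono q⊆⁅<M⁆─p ⊆-refl ([p─q]∩q≡⊥ ⁅< M ⁆ p) , ∣q∣≡b
  where
  open ≤-Reasoning
  room : b ≤ ∣ ⁅< M ⁆ ─ p ∣
  room = +-cancelˡ-≤ ∣ p ∣ b _ (begin
    ∣ p ∣ + b                ≤⟨ ∣p∣+b≤M ⟩
    M                        ≡⟨ ∣⁅<M⁆∣≡M M≤N ⟨
    ∣ ⁅<_⁆ {N} M ∣           ≤⟨ ∣p∣≤∣p─q∣+∣q∣ ⁅< M ⁆ p ⟩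
    ∣ ⁅< M ⁆ ─ p ∣ + ∣ p ∣   ≡⟨ +-comm _ ∣ p ∣ ⟩
    ∣ p ∣ + ∣ ⁅< M ⁆ ─ p ∣   ∎)

module _ {N : ℕ} (𝒜 ℬ : Subset N → Set) where

  Chain : ℕ → Subset N → Subset N → Set
  Chain w A B = Σ (Fin (suc w) → Subset N) λ As → Σ (Fin (suc w) → Subset N) λ Bs →
    ((∀ (i : Fin (suc w)) → 𝒜 (As i) × ℬ (Bs i))
    × (∀ (i : Fin (suc w)) → As i ∩ Bs i ≡ ⊥)
    × (∀ (i : Fin w) → As (suc i) ∩ Bs (inject₁ i) ≡ ⊥)
    × As zero ≡ A × Bs (fromℕ w) ≡ B)

  ExchangeStep : Set
  ExchangeStep = ∀ {w A B} → 𝒜 A → ℬ B → ∣ A ∩ B ∣ ≡ suc w →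
    ∃₂ λ A′ B′ → 𝒜 A′ × ℬ B′ × ∣ A′ ∩ B ∣ ≡ w × A ∩ B′ ≡ ⊥ × A′ ∩ B′ ≡ ⊥

  chain-[] : ∀ {A B} → 𝒜 A → ℬ B → A ∩ B ≡ ⊥ → Chain 0 A B
  chain-[] {A} {B} A∈𝒜 B∈ℬ A∩B≡⊥ =
    (λ _ → A) , (λ _ → B) , (λ _ → A∈𝒜 , B∈ℬ) , (λ _ → A∩B≡⊥) , (λ ()) , refl , refl

  chain-∷ : ∀ {w A A′ B B′} → 𝒜 A → ℬ B′ → A ∩ B′ ≡ ⊥ → A′ ∩ B′ ≡ ⊥ → Chain w A′ B → Chain (suc w) A B
  chain-∷ {A = A} {B′ = B′} A∈𝒜 B′∈ℬ A∩B′≡⊥ A′∩B′≡⊥ (As , Bs , members , disjoint , disjoint-next , refl , last) =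
    A Vector.∷ As , B′ Vector.∷ Bs
    , (λ { zero → A∈𝒜 , B′∈ℬ ; (suc i) → members i })
    , (λ { zero → A∩B′≡⊥ ; (suc i) → disjoint i })
    , (λ { zero → A′∩B′≡⊥ ; (suc i) → disjoint-next i })
    , refl , last

  chain : ExchangeStep → ∀ w {A B} → 𝒜 A → ℬ B → ∣ A ∩ B ∣ ≡ w → Chain w A B
  chain step zero    A∈𝒜 B∈ℬ ∣A∩B∣≡0 = chain-[] A∈𝒜 B∈ℬ (∣p∣≡0⇒p≡⊥ _ ∣A∩B∣≡0)
  chain step (suc w) A∈𝒜 B∈ℬ ∣A∩B∣≡1+w =
    let A′ , B′ , A′∈𝒜 , B′∈ℬ , ∣A′∩B∣≡w , A∩B′≡⊥ , A′∩B′≡⊥ = step A∈𝒜 B∈ℬ ∣A∩B∣≡1+w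
    in chain-∷ A∈𝒜 B′∈ℬ A∩B′≡⊥ A′∩B′≡⊥ (chain step w A′∈𝒜 B∈ℬ ∣A′∩B∣≡w)

module _ {N M n m a b : ℕ} {T : Subset N} {j : Fin N} (M≤N : M ≤ N) (M≤n : M ≤ n) (M≤m : M ≤ m)
         (room : ∣ T ∪ ⁅ j ⁆ ∣ + a + b < M) where

  private
    S : Subset N
    S = T ∪ ⁅ j ⁆

    room-for-Z : ∀ {A B : Subset N} → ∣ A ∣ ≡ a → ∣ B ∣ ≡ b → ∣ S ∪ (A ∪ B) ∣ + 1 ≤ M
    room-for-Z {A} {B} ∣A∣≡a ∣B∣≡b = begin
      ∣ S ∪ (A ∪ B) ∣ + 1        ≤⟨ +-monoˡ-≤ 1 (∣p∪[q∪r]∣≤∣p∣+∣q∣+∣r∣ S A B) ⟩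
      ∣ S ∣ + ∣ A ∣ + ∣ B ∣ + 1  ≡⟨ cong₂ (λ x y → ∣ S ∣ + x + y + 1) ∣A∣≡a ∣B∣≡b ⟩
      ∣ S ∣ + a + b + 1          ≡⟨ +-comm _ 1 ⟩
      suc (∣ S ∣ + a + b)        ≤⟨ room ⟩
      M                          ∎
      where open ≤-Reasoning

    room-for-B′ : ∀ {A Z : Subset N} → ∣ A ∣ ≡ a → ∣ Z ∣ ≡ 1 → ∣ S ∪ (A ∪ Z) ∣ + b ≤ M
    room-for-B′ {A} {Z} ∣A∣≡a ∣Z∣≡1 = begin
      ∣ S ∪ (A ∪ Z) ∣ + b        ≤⟨ +-monoˡ-≤ b (∣p∪[q∪r]∣≤∣p∣+∣q∣+∣r∣ S A Z) ⟩
      ∣ S ∣ + ∣ A ∣ + ∣ Z ∣ + b  ≡⟨ cong₂ (λ x y → ∣ S ∣ + x + y + b) ∣A∣≡a ∣Z∣≡1 ⟩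
      ∣ S ∣ + a + 1 + b          ≡⟨ +-assoc (∣ S ∣ + a) 1 b ⟩
      ∣ S ∣ + a + suc b          ≡⟨ +-suc (∣ S ∣ + a) b ⟩
      suc (∣ S ∣ + a + b)        ≤⟨ room ⟩
      M                          ∎
      where open ≤-Reasoning

  inFamily-exchange : ExchangeStep (InFamily n T j a) (InFamily m T j b)
  inFamily-exchange {w} {A} {B} (A<n , A∩S≡⊥ , ∣A∣≡a) (_ , _ , ∣B∣≡b) ∣A∩B∣≡1+w
    with subset-of-size (A ∩ B) (subst (1 ≤_) (sym ∣A∩B∣≡1+w) (s≤s z≤n))
  ... | X , X⊆A∩B , ∣X∣≡1
    with fresh M≤N (S ∪ (A ∪ B)) (room-for-Z ∣A∣≡a ∣B∣≡b)
  ... | Z , Z<M , Z∩[S∪[A∪B]]≡⊥ , ∣Z∣≡1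
    with fresh M≤N (S ∪ (A ∪ Z)) (room-for-B′ ∣A∣≡a ∣Z∣≡1)
  ... | B′ , B′<M , B′∩[S∪[A∪Z]]≡⊥ , ∣B′∣≡b =
    A′ , B′ , (A′<n , A′∩S≡⊥ , ∣A′∣≡a) , (withinRange-mono M≤m B′<M , B′∩S≡⊥ , ∣B′∣≡b)
    , ∣A′∩B∣≡w , ∩≡⊥-sym B′∩A≡⊥ , ∩≡⊥-sym B′∩A′≡⊥
    where
    A′ : Subset N
    A′ = (A ─ X) ∪ Z

    Z∩S≡⊥ : Z ∩ S ≡ ⊥
    Z∩S≡⊥ = ∩≡⊥-antimono ⊆-refl (p⊆p∪q (A ∪ B)) Z∩[S∪[A∪B]]≡⊥
    Z∩A≡⊥ : Z ∩ A ≡ ⊥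
    Z∩A≡⊥ = ∩≡⊥-antimono ⊆-refl (⊆-trans (p⊆p∪q B) (q⊆p∪q S (A ∪ B))) Z∩[S∪[A∪B]]≡⊥
    Z∩B≡⊥ : Z ∩ B ≡ ⊥
    Z∩B≡⊥ = ∩≡⊥-antimono ⊆-refl (⊆-trans (q⊆p∪q A B) (q⊆p∪q S (A ∪ B))) Z∩[S∪[A∪B]]≡⊥

    A′⊆A∪Z : A′ ⊆ A ∪ Z
    A′⊆A∪Z = [p─q]∪r⊆p∪r A X Z
    A′<n : WithinRange n A′
    A′<n = withinRange-⊆ A′⊆A∪Z (withinRange-∪ A<n (withinRange-mono M≤n Z<M))
    A′∩S≡⊥ : A′ ∩ S ≡ ⊥
    A′∩S≡⊥ = ∩≡⊥-antimono A′⊆A∪Z ⊆-refl (∪-∩≡⊥ A∩S≡⊥ Z∩S≡⊥)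
    ∣A′∣≡a : ∣ A′ ∣ ≡ a
    ∣A′∣≡a = trans (∣[p─q]∪r∣≡∣p∣ A X Z (⊆-trans X⊆A∩B (p∩q⊆p A B)) Z∩A≡⊥ (trans ∣X∣≡1 (sym ∣Z∣≡1))) ∣A∣≡a
    ∣A′∩B∣≡w : ∣ A′ ∩ B ∣ ≡ w
    ∣A′∩B∣≡w = suc-injective (begin
      suc ∣ A′ ∩ B ∣         ≡⟨ +-comm 1 _ ⟩
      ∣ A′ ∩ B ∣ + 1         ≡⟨ cong (∣ A′ ∩ B ∣ +_) ∣X∣≡1 ⟨
      ∣ A′ ∩ B ∣ + ∣ X ∣     ≡⟨ ∣[[p─q]∪r]∩s∣+∣q∣≡∣p∩s∣ A X Z B X⊆A∩B Z∩B≡⊥ ⟩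
      ∣ A ∩ B ∣              ≡⟨ ∣A∩B∣≡1+w ⟩
      suc w                  ∎)
      where open ≡-Reasoning

    B′∩S≡⊥ : B′ ∩ S ≡ ⊥
    B′∩S≡⊥ = ∩≡⊥-antimono ⊆-refl (p⊆p∪q (A ∪ Z)) B′∩[S∪[A∪Z]]≡⊥
    B′∩A≡⊥ : B′ ∩ A ≡ ⊥
    B′∩A≡⊥ = ∩≡⊥-antimono ⊆-refl (⊆-trans (p⊆p∪q Z) (q⊆p∪q S (A ∪ Z))) B′∩[S∪[A∪Z]]≡⊥
    B′∩A′≡⊥ : B′ ∩ A′ ≡ ⊥
    B′∩A′≡⊥ = ∩≡⊥-antimono ⊆-refl (⊆-trans A′⊆A∪Z (q⊆p∪q S (A ∪ Z))) B′∩[S∪[A∪Z]]≡⊥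

t+2r+1+[k∸r∸t]+[l∸r∸t]<k+l∸t+2 : ∀ {k l t r} → l ≤ k → t + r ≤ l → t + 2 * r + 1 + (k ∸ r ∸ t) + (l ∸ r ∸ t) < k + l ∸ t + 2
t+2r+1+[k∸r∸t]+[l∸r∸t]<k+l∸t+2 {k} {l} {t} {r} l≤k t+r≤l = ≤-reflexive (begin
  suc (t + 2 * r + 1 + (k ∸ r ∸ t) + (l ∸ r ∸ t))
    ≡⟨ cong₂ (λ x y → suc (t + 2 * r + 1 + x + y)) (∸-+-assoc k r t) (∸-+-assoc l r t) ⟩
  suc (t + 2 * r + 1 + u + v)          ≡⟨ rearrange t r u v ⟩
  u + v + 2 * r + t + 2                ≡⟨ cong (_+ 2) (m+n∸n≡m _ t) ⟨
  u + v + 2 * r + t + t ∸ t + 2        ≡⟨ cong (λ x → x ∸ t + 2) (regroup u v r t) ⟩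
  u + (r + t) + (v + (r + t)) ∸ t + 2  ≡⟨ cong₂ (λ x y → x + y ∸ t + 2) (m∸n+n≡m r+t≤k) (m∸n+n≡m r+t≤l) ⟩
  k + l ∸ t + 2                        ∎)
  where
  open ≡-Reasoning
  u v : ℕ
  u = k ∸ (r + t)
  v = l ∸ (r + t)
  r+t≤l : r + t ≤ l
  r+t≤l = subst (_≤ l) (+-comm t r) t+r≤l
  r+t≤k : r + t ≤ k
  r+t≤k = ≤-trans r+t≤l l≤k
  rearrange : ∀ t r u v → suc (t + 2 * r + 1 + u + v) ≡ u + v + 2 * r + t + 2
  rearrange = solve-∀
  regroup : ∀ u v r t → u + v + 2 * r + t + t ≡ u + (r + t) + (v + (r + t))
  regroup = solve-∀

lemma4p3 : (m n k l t r : ℕ) → 1 ≤ m → 1 ≤ n → 1 ≤ k → 1 ≤ l → 1 ≤ t → 1 ≤ r →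
    l ≤ k → t + r ≤ l → k + l ∸ t + 2 ≤ m ⊓ n →
    (T : Subset (m ⊔ n)) → WithinRange (m ⊓ n) T → ∣ T ∣ ≡ t + 2 * r →
    (j : Fin (m ⊔ n)) → toℕ j < m ⊓ n → j ∉ T →
    (A B : Subset (m ⊔ n)) →
    InFamily n T j (k ∸ r ∸ t) A → InFamily m T j (l ∸ r ∸ t) B →
    (w : ℕ) → ∣ A ∩ B ∣ ≡ w →
    Σ (Fin (suc w) → Subset (m ⊔ n)) λ As → Σ (Fin (suc w) → Subset (m ⊔ n)) λ Bs →
      ((∀ (i : Fin (suc w)) → InFamily n T j (k ∸ r ∸ t) (As i) × InFamily m T j (l ∸ r ∸ t) (Bs i))
      × (∀ (i : Fin (suc w)) → As i ∩ Bs i ≡ ⊥)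
      × (∀ (i : Fin w) → As (suc i) ∩ Bs (inject₁ i) ≡ ⊥)
      × As zero ≡ A × Bs (fromℕ w) ≡ B)
lemma4p3 m n k l t r _ _ _ _ _ _ l≤k t+r≤l k+l∸t+2≤m⊓n T _ ∣T∣≡t+2r j _ _ A B A∈𝒜 B∈ℬ w ∣A∩B∣≡w =
  chain (InFamily n T j (k ∸ r ∸ t)) (InFamily m T j (l ∸ r ∸ t))
    (inFamily-exchange (m⊓n≤m⊔n m n) (m⊓n≤n m n) (m⊓n≤m m n) room) w A∈𝒜 B∈ℬ ∣A∩B∣≡w
  where
  ∣T∪⁅j⁆∣≤t+2r+1 : ∣ T ∪ ⁅ j ⁆ ∣ ≤ t + 2 * r + 1
  ∣T∪⁅j⁆∣≤t+2r+1 = ≤-trans (∣p∪q∣≤∣p∣+∣q∣ T ⁅ j ⁆) (≤-reflexive (cong₂ _+_ ∣T∣≡t+2r (∣⁅x⁆∣≡1 j)))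
  room : ∣ T ∪ ⁅ j ⁆ ∣ + (k ∸ r ∸ t) + (l ∸ r ∸ t) < m ⊓ n
  room = <-≤-trans (≤-<-trans (+-monoˡ-≤ _ (+-monoˡ-≤ _ ∣T∪⁅j⁆∣≤t+2r+1))
                              (t+2r+1+[k∸r∸t]+[l∸r∸t]<k+l∸t+2 {t = t} {r} l≤k t+r≤l))
                   k+l∸t+2≤m⊓n
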